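{- ${\sf SP}\subseteq{\sf PB}$: if a family $\{f_n:\{0,1\}^n\times\{0,1\}^n\to\{0,1\}\}$ has, for some constant $s$, secure read-only oblivious card-based protocols of length polynomial in $n$ with deck size $s$ and work space size $2s$, then $\{f_n\}$ is computable by layered branching programs of constant width and polynomial length.
   Context: Card-based protocols: Alice holds $x\in\{0,1\}^n$, Bob holds $y\in\{0,1\}^n$. Cards have suit $\heartsuit$ or $\clubsuit$ and identical backs; in the 2-card encoding bit $1$ is the face-down pair $\heartsuit\clubsuit$ and bit $0$ is $\clubsuit\heartsuit$. Table positions are $1,\dots,m$: $1,\dots,2n$ Alice's input cards, $2n+1,\dots,4n$ Bob's, $4n+1,\dots,4n+s$ a deck of $s$ auxiliary cards, $4n+s+1,\dots,m$ initially empty; positions $4n+1,\dots,m$ form the work space. Actions: Move($p,i,j$) (move a card from position $i$ to $j$), Shuffle($p,T,\Gamma$) (player $p$ applies a random permutation from $\Gamma$ to cards on positions $T$ in the work space), Turn($p,i$). The visible state is which positions are occupied and the visible face of each card. A protocol chooses the next action (or termination, with a designation of output cards) from the sequence of visible states so far; it computes $f$ if it outputs $f(x,y)$ on every input. Length is the maximum number of actions over all inputs and shuffle outcomes. Oblivious: next action depends only on current visible state and number of actions taken. Secure: for inputs $(x,y),(x',y')$ with $f(x,y)=f(x',y')$ the distributions of the sequence of visible states coincide. Read-only: the card on any input position $1,\dots,4n$, whenever the position is occupied, has the same value as initially. Branching programs: a branching program for $f:\{0,1\}^N\to\{0,1\}$ is a directed acyclic graph whose vertices have out-degree 2 or 0,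 each out-degree-2 vertex labeled by an index $\ell\in[N]$ with one outgoing zero-edge and one one-edge; there is an initial vertex and some out-degree-0 vertices are accepting; on input $x$ one follows from a vertex labeled $\ell$ the edge marked $x_\ell$, accepting iff the final vertex is accepting. It is layered if its vertices are partitioned into layers $L_1,\dots,L_d$ with edges only from $L_i$ to $L_{i+1}$ and out-degree-0 vertices exactly in $L_d$; width is $\max_i|L_i|$, length is $d$. ${\sf PB}$ is the class of functions computable by layered branching programs of constant width and polynomial length. -}

module Defs where

open import Data.Nat using (ℕ; zero; suc; _+_; _*_; _≤_; _⊔_)
open import Data.Bool using (Bool; true; false; if_then_else_; not)
open import Data.Fin using (Fin; toℕ)
open import Data.Fin.Permutation using (Permutation′; _⟨$⟩ʳ_; _⟨$⟩ˡ_)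
open import Data.Fin.Subset using (Subset)
open import Data.Maybe using (Maybe; just; nothing)
import Data.Maybe.Properties as MaybeP
open import Data.Vec using (Vec; []; _∷_; lookup; tabulate; concat; replicate; _++_; _[_]≔_)
import Data.Vec as Vec
import Data.Vec.Properties as VecP
open import Data.List using (List; []; _∷_; length; foldr)
import Data.List as List
open import Data.List.Relation.Unary.All using (All)
open import Data.List.Relation.Unary.AllPairs using (AllPairs)
open import Data.Product using (Σ; _×_; _,_; proj₁; proj₂; ∃)
open import Data.Unit using (⊤)
open import Data.Empty using (⊥)
open import Data.Integer using (+_)
open import Data.Rational using (ℚ; 0ℚ; 1ℚ; _/_) renaming (_+_ to _+ℚ_; _*_ to _*ℚ_)
open import Relation.Nullary using (¬_; yes; no)
open import Relation.Binary.Definitions using (DecidableEquality)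
open import Relation.Binary.PropositionalEquality using (_≡_; refl)

data Suit : Set where
  ♥ ♣ : Suit

_≟ˢ_ : DecidableEquality Suit
♥ ≟ˢ ♥ = yes refl
♥ ≟ˢ ♣ = no λ ()
♣ ≟ˢ ♥ = no λ ()
♣ ≟ˢ ♣ = yes refl

-- a card: its suit and whether it lies face up (true) or face down (false)
Card : Set
Card = Suit × Bool

encodeBit : Bool → Vec Card 2
encodeBit true  = (♥ , false) ∷ (♣ , false) ∷ []
encodeBit false = (♣ , false) ∷ (♥ , false) ∷ []

encode : ∀ {n} → Vec Bool n → Vec Card (n * 2)
encode x = concat (Vec.map encodeBit x)

decodePair : Maybe Card → Maybe Card → Maybe Bool
decodePair (just (♥ , _)) (just (♣ , _)) = just true
decodePair (just (♣ , _)) (just (♥ , _)) = just false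
decodePair _ _ = nothing

-- Table layout: Alice's 2n input cards, Bob's 2n input cards,
-- a deck of s auxiliary cards, then s initially empty positions.
-- Hence the work space (deck + empty positions) has size 2s.

inputSize : ℕ → ℕ
inputSize n = n * 2 + n * 2

tableSize : ℕ → ℕ → ℕ
tableSize n s = (n * 2 + (n * 2 + s)) + s

-- content of a position: nothing = empty
Config : ℕ → Set
Config m = Vec (Maybe Card) m

initialConfig : ∀ {n s} → Vec Bool n → Vec Bool n → Vec Card s → Config (tableSize n s)
initialConfig {n} {s} x y deck =
  Vec.map just (encode x ++ (encode y ++ deck)) ++ replicate s nothing

InputPos : ∀ {m} → ℕ → Fin m → Set
InputPos n i = suc (toℕ i) ≤ inputSize n

WorkPos : ∀ {m} → ℕ → Fin m → Set
WorkPos n i = inputSize n ≤ toℕ i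

-- Visible states: nothing = empty position, just nothing = a card
-- showing its back, just (just σ) = a face-up card of suit σ.

Visible : ℕ → Set
Visible m = Vec (Maybe (Maybe Suit)) m

visCard : Maybe Card → Maybe (Maybe Suit)
visCard nothing = nothing
visCard (just (σ , true))  = just (just σ)
visCard (just (σ , false)) = just nothing

vis : ∀ {m} → Config m → Visible m
vis = Vec.map visCard

_≟ᵛ_ : ∀ {m} → DecidableEquality (Visible m)
_≟ᵛ_ = VecP.≡-dec (MaybeP.≡-dec (MaybeP.≡-dec _≟ˢ_))

data Player : Set where
  alice bob : Player

-- Shuffle(p, T, Γ): T ⊆ work space, Γ a non-empty set (no repetitions)
-- of permutations of the table positions, each fixing every position
-- outside T; a uniformly random element of Γ is applied.
record ShuffleSpec (n m : ℕ) : Set where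
  field
    T        : Subset m
    T⊆work   : ∀ i → lookup T i ≡ true → WorkPos n i
    Γ        : List (Permutation′ m)
    nonEmpty : ¬ (Γ ≡ [])
    fixes    : All (λ π → ∀ i → lookup T i ≡ false → π ⟨$⟩ʳ i ≡ i) Γ
    distinct : AllPairs (λ π ρ → ¬ (∀ i → π ⟨$⟩ʳ i ≡ ρ ⟨$⟩ʳ i)) Γ

data Action (n m : ℕ) : Set where
  move    : Player → Fin m → Fin m → Action n m
  shuffle : Player → ShuffleSpec n m → Action n m
  turn    : Player → Fin m → Action n m

-- next step of a protocol: an action, or termination with the
-- designation of the two output cards (2-card encoding)
data Decision (n m : ℕ) : Set where
  act  : Action n m → Decision n m
  stop : Fin m → Fin m → Decision n m

flipCard : Maybe Card → Maybe Card
flipCard nothing = nothing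
flipCard (just (σ , u)) = just (σ , not u)

-- possible results of an action (each equally likely).
-- A move from an empty position or onto an occupied one leaves the
-- table unchanged.
outcomes : ∀ {n m} → Action n m → Config m → List (Config m)
outcomes (move _ i j) c with lookup c i | lookup c j
... | just card | nothing = ((c [ i ]≔ nothing) [ j ]≔ just card) ∷ []
... | _         | _       = c ∷ []
outcomes (turn _ i) c = (c [ i ]≔ flipCard (lookup c i)) ∷ []
outcomes (shuffle _ S) c =
  List.map (λ π → tabulate (λ j → lookup c (π ⟨$⟩ˡ j))) (ShuffleSpec.Γ S)

-- Protocols. The next decision is a function of the sequence of
-- visible states so far: the current one and the list of earlier ones
-- (most recent first).

record Protocol (n s : ℕ) : Set where
  field
    next : Visible (tableSize n s) → List (Visible (tableSize n s)) →
           Decision n (tableSize n s)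
open Protocol public

Oblivious : ∀ {n s} → Protocol n s → Set
Oblivious {n} {s} P =
  Σ (ℕ → Visible (tableSize n s) → Decision n (tableSize n s)) λ g →
    ∀ v past → next P v past ≡ g (length past) v

module Run (n s : ℕ) (P : Protocol n s) where
  m : ℕ
  m = tableSize n s

  mutual
    Halts : ℕ → List (Visible m) → Config m → Set
    Halts L past c = haltsD L past c (next P (vis c) past)

    haltsD : ℕ → List (Visible m) → Config m → Decision n m → Set
    haltsD _ _ _ (stop _ _) = ⊤
    haltsD zero _ _ (act _) = ⊥
    haltsD (suc L) past c (act a) = All (Halts L (vis c ∷ past)) (outcomes a c)

  mutual
    Always : (Config m → Set) → (Config m → Fin m → Fin m → Set) →
             ℕ → List (Visible m) → Config m → Set
    Always R Q k past c = R c × alwaysD R Q k past c (next P (vis c) past)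

    alwaysD : (Config m → Set) → (Config m → Fin m → Fin m → Set) →
              ℕ → List (Visible m) → Config m → Decision n m → Set
    alwaysD R Q _ _ c (stop i j) = Q c i j
    alwaysD R Q zero _ _ (act _) = ⊤
    alwaysD R Q (suc k) past c (act a) =
      All (Always R Q k (vis c ∷ past)) (outcomes a c)

  -- probability that the sequence of visible states of an execution
  -- (with at most k actions, from table c after history past) is tr
  sumℚ : List ℚ → ℚ
  sumℚ = foldr _+ℚ_ 0ℚ

  average : List ℚ → ℚ
  average [] = 0ℚ
  average (q ∷ qs) = sumℚ (q ∷ qs) *ℚ ((+ 1) / suc (length qs))

  mutual
    prob : ℕ → List (Visible m) → Config m → List (Visible m) → ℚ
    prob k past c [] = 0ℚ
    prob k past c (v ∷ rest) with vis c ≟ᵛ v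
    ... | no _  = 0ℚ
    ... | yes _ = probD k past c rest (next P (vis c) past)

    probD : ℕ → List (Visible m) → Config m → List (Visible m) → Decision n m → ℚ
    probD k past c [] (stop _ _) = 1ℚ
    probD k past c (_ ∷ _) (stop _ _) = 0ℚ
    probD zero past c rest (act a) = 0ℚ
    probD (suc k) past c rest (act a) =
      average (List.map (λ c' → prob k (vis c ∷ past) c' rest) (outcomes a c))

open Run public

LengthAtMost : ∀ {n s} → Protocol n s → Vec Card s → ℕ → Set
LengthAtMost {n} {s} P deck L =
  ∀ x y → Halts n s P L [] (initialConfig {n} x y deck)

Computes : ∀ {n s} → Protocol n s → Vec Card s →
           (Vec Bool n → Vec Bool n → Bool) → Set
Computes {n} {s} P deck f =
  ∀ x y k → Always n s P (λ _ → ⊤)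
                     (λ c i j → decodePair (lookup c i) (lookup c j) ≡ just (f x y))
                     k [] (initialConfig {n} x y deck)

Secure : ∀ {n s} → Protocol n s → Vec Card s →
         (Vec Bool n → Vec Bool n → Bool) → Set
Secure {n} {s} P deck f =
  ∀ x y x' y' → f x y ≡ f x' y' →
  ∀ k tr → prob n s P k [] (initialConfig {n} x y deck) tr
         ≡ prob n s P k [] (initialConfig {n} x' y' deck) tr

ReadOnly : ∀ {n s} → Protocol n s → Vec Card s → Set
ReadOnly {n} {s} P deck =
  ∀ x y k → Always n s P
    (λ c → ∀ i → InputPos n i → ∀ card → lookup c i ≡ just card →
            ∃ λ σ → lookup (initialConfig {n} x y deck) i ≡ just (proj₁ card , σ))
    (λ _ _ _ → ⊤) k [] (initialConfig {n} x y deck)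

-- LBP N w: a sequence of layers whose first layer has w vertices.
-- A non-final layer assigns to each vertex a variable index and its
-- zero-successor and one-successor in the next layer; the final layer
-- consists of the out-degree-0 vertices, with the accepting ones marked.

data LBP (N : ℕ) : ℕ → Set where
  final : ∀ {w} → (Fin w → Bool) → LBP N w
  layer : ∀ {w w'} → (Fin w → Fin N × Fin w' × Fin w') → LBP N w' → LBP N w

lbpLength : ∀ {N w} → LBP N w → ℕ
lbpLength (final _) = 1
lbpLength (layer _ B) = suc (lbpLength B)

lbpWidth : ∀ {N w} → LBP N w → ℕ
lbpWidth {w = w} (final _) = w
lbpWidth {w = w} (layer _ B) = w ⊔ lbpWidth B

lbpEval : ∀ {N w} → LBP N w → Fin w → Vec Bool N → Bool
lbpEval (final acc) v z = acc v
lbpEval (layer E B) v z with E v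
... | ℓ , v₀ , v₁ = lbpEval B (if lookup z ℓ then v₁ else v₀) z

-- Follow the visible trace of the execution on the all-zero input.  After t actions the vertex of
-- the branching program is the set of work-space contents (deck and initially empty positions)
-- that the execution on the actual input can have after t actions showing these visible states;
-- as the work space has 2s positions there are constantly many such sets.  Since the protocol is
-- read-only, an input card is determined by its visible face and the bit it encodes, so the next
-- set depends only on the bit of the one input card that the action moves or turns: each action
-- becomes a layer reading that bit.  At the end the program reads the bits at the two output
-- positions and decodes the output from any surviving work space.  If none survives, the actual
-- execution has left the trace; by security this happens only when its output differs from the
-- output on the all-zero input, so the program outputs the negation of the latter.
module Submission where

open import Defs hiding (m)
open import Data.Bool using (Bool; true; false; not; if_then_else_; T; T?)
open import Data.Bool.Properties using (¬-not)
open import Data.Empty using (⊥-elim)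
open import Data.Fin using (Fin; zero; suc; toℕ; _↑ˡ_; _↑ʳ_; remQuot; combine; _≟_)
import Data.Fin.Properties as Finₚ
open import Data.Fin.Permutation using (Permutation′; _⟨$⟩ʳ_; _⟨$⟩ˡ_; inverseʳ)
open import Data.Integer using (+_)
open import Data.List using (List; []; _∷_; length; foldr)
import Data.List as List
open import Data.List.Membership.Propositional using (_∈_; find; lose)
open import Data.List.Membership.Propositional.Properties using (∈-map⁻; ∈-map⁺)
open import Data.List.Relation.Unary.All as All using (All; []; _∷_)
import Data.List.Relation.Unary.All.Properties as Allₚ
import Data.List.Relation.Unary.Any.Properties as Anyₚ
open import Data.List.Relation.Unary.Any as Any using (Any; here; there)
open import Data.Maybe using (Maybe; just; nothing; maybe; fromMaybe)
open import Data.Maybe.Properties using (just-injective)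
open import Data.Nat using (ℕ; zero; suc; _+_; _*_; _^_; _≤_; z≤n; s≤s)
import Data.Nat.Properties as ℕₚ
open import Data.Product using (Σ; ∃; _×_; _,_; proj₁; proj₂)
open import Data.Rational as ℚ using (0ℚ; 1ℚ; _/_)
import Data.Rational.Properties as ℚₚ
open import Data.Sum using (_⊎_; inj₁; inj₂)
open import Data.Unit using (tt)
open import Data.Vec using (Vec; []; _∷_; lookup; tabulate; _++_; replicate; _[_]≔_)
import Data.Vec as Vec
import Data.Vec.Properties as Vecₚ
open import Data.Vec.Relation.Binary.Pointwise.Extensional using (ext; Pointwise-≡⇒≡)
open import Function using (_∘_; case_of_; _⇔_; mk⇔; Equivalence)
open import Relation.Binary.Definitions using (DecidableEquality)
open import Relation.Binary.PropositionalEquality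
open import Relation.Nullary using (¬_; Dec; yes; no; does)
open import Relation.Nullary.Decidable using (map′; _×-dec_)
open import Relation.Unary using (Decidable)

open Equivalence using (to; from)

record Finite (A : Set) : Set where
  field
    size        : ℕ
    enum        : Fin size → A
    index       : A → Fin size
    enum-index  : ∀ a → enum (index a) ≡ a
open Finite public

module FiniteProperties {A : Set} (F : Finite A) where

  ≡-dec : DecidableEquality A
  ≡-dec a b = map′ index-injective (cong (index F)) (index F a ≟ index F b)
    where
    index-injective : index F a ≡ index F b → a ≡ b
    index-injective eq = trans (sym (enum-index F a)) (trans (cong (enum F) eq) (enum-index F b))

  ∃? : {P : A → Set} → Decidable P → Dec (∃ P)
  ∃? {P} P? = map′ (λ (k , p) → enum F k , p)
                   (λ (a , p) → index F a , subst P (sym (enum-index F a)) p)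
                   (Finₚ.any? (P? ∘ enum F))

module Subsets {A : Set} (F : Finite A) where

  Subset : Set
  Subset = Vec Bool (size F)

  member : Subset → A → Bool
  member S a = lookup S (index F a)

  _Represents_ : Subset → (A → Set) → Set
  S Represents R = ∀ a → T (member S a) ⇔ R a

  fromDecidable : {P : A → Set} → Decidable P → Subset
  fromDecidable P? = tabulate (does ∘ P? ∘ enum F)

  member-fromDecidable : {P : A → Set} (P? : Decidable P) (a : A) →
                         member (fromDecidable P?) a ≡ does (P? a)
  member-fromDecidable P? a =
    trans (Vecₚ.lookup∘tabulate _ (index F a)) (cong (does ∘ P?) (enum-index F a))

  fromDecidable-represents : {P : A → Set} (P? : Decidable P) → fromDecidable P? Represents P
  fromDecidable-represents P? a rewrite member-fromDecidable P? a with P? a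
  ... | yes p = mk⇔ (λ _ → p) (λ _ → tt)
  ... | no ¬p = mk⇔ (λ ()) ¬p

finite-Bool : Finite Bool
finite-Bool = record
  { size = 2 ; enum = enum′ ; index = index′ ; enum-index = λ { false → refl ; true → refl } }
  where
  enum′ : Fin 2 → Bool
  enum′ zero    = false
  enum′ (suc _) = true
  index′ : Bool → Fin 2
  index′ false = zero
  index′ true  = suc zero

finite-Suit : Finite Suit
finite-Suit = record
  { size = 2 ; enum = enum′ ; index = index′ ; enum-index = λ { ♥ → refl ; ♣ → refl } }
  where
  enum′ : Fin 2 → Suit
  enum′ zero    = ♥
  enum′ (suc _) = ♣
  index′ : Suit → Fin 2
  index′ ♥ = zero
  index′ ♣ = suc zero

finite-Maybe : ∀ {A} → Finite A → Finite (Maybe A)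
finite-Maybe {A} F = record
  { size = suc (size F) ; enum = enum′ ; index = maybe (suc ∘ index F) zero
  ; enum-index = λ { nothing → refl ; (just a) → cong just (enum-index F a) } }
  where
  enum′ : Fin (suc (size F)) → Maybe A
  enum′ zero    = nothing
  enum′ (suc k) = just (enum F k)

finite-× : ∀ {A B} → Finite A → Finite B → Finite (A × B)
finite-× F G = record
  { size = size F * size G
  ; enum = λ k → let (i , j) = remQuot (size G) k in enum F i , enum G j
  ; index = λ (a , b) → combine (index F a) (index G b)
  ; enum-index = λ (a , b) →
      trans (cong (λ (i , j) → enum F i , enum G j) (Finₚ.remQuot-combine (index F a) (index G b)))
            (cong₂ _,_ (enum-index F a) (enum-index G b)) }

finite-Vec : ∀ {A} → Finite A → ∀ k → Finite (Vec A k)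
finite-Vec F zero = record { size = 1 ; enum = λ _ → [] ; index = λ _ → zero ; enum-index = λ { [] → refl } }
finite-Vec F (suc k) = record
  { size = size F×Fᵏ
  ; enum = λ i → let (a , as) = enum F×Fᵏ i in a ∷ as
  ; index = λ { (a ∷ as) → index F×Fᵏ (a , as) }
  ; enum-index = λ { (a ∷ as) → cong (λ (a , as) → a ∷ as) (enum-index F×Fᵏ (a , as)) } }
  where F×Fᵏ = finite-× F (finite-Vec F k)

module _ {N : ℕ} {A A' : Set} (F : Finite A) (F' : Finite A') where

  readLayer : Fin N → (A → Bool → A') → LBP N (size F') → LBP N (size F)
  readLayer ℓ δ = layer λ u → ℓ , index F' (δ (enum F u) false) , index F' (δ (enum F u) true)

  lbpEval-readLayer : ∀ ℓ δ B a z →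
                      lbpEval (readLayer ℓ δ B) (index F a) z ≡ lbpEval B (index F' (δ a (lookup z ℓ))) z
  lbpEval-readLayer ℓ δ B a z =
    trans (cong (λ v → lbpEval B v z) (branch (enum F (index F a)) (lookup z ℓ)))
          (cong (λ a′ → lbpEval B (index F' (δ a′ (lookup z ℓ))) z) (enum-index F a))
    where
    branch : ∀ a′ b → (if b then index F' (δ a′ true) else index F' (δ a′ false)) ≡ index F' (δ a′ b)
    branch a′ true  = refl
    branch a′ false = refl

module _ {N : ℕ} {A : Set} (F : Finite A) where

  finalLayer : (A → Bool) → LBP N (size F)
  finalLayer h = final (h ∘ enum F)

  lbpEval-finalLayer : ∀ h a z → lbpEval (finalLayer h) (index F a) z ≡ h a
  lbpEval-finalLayer h a z = cong h (enum-index F a)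

sumℚ-nonneg : ∀ {qs} → All (0ℚ ℚ.≤_) qs → 0ℚ ℚ.≤ foldr ℚ._+_ 0ℚ qs
sumℚ-nonneg []       = ℚₚ.≤-refl
sumℚ-nonneg (p ∷ ps) = ℚₚ.+-mono-≤ p (sumℚ-nonneg ps)

sumℚ-pos : ∀ {qs} → All (0ℚ ℚ.≤_) qs → Any (0ℚ ℚ.<_) qs → 0ℚ ℚ.< foldr ℚ._+_ 0ℚ qs
sumℚ-pos (_ ∷ ps) (here p)  = ℚₚ.+-mono-<-≤ p (sumℚ-nonneg ps)
sumℚ-pos (p ∷ ps) (there q) = ℚₚ.+-mono-≤-< p (sumℚ-pos ps q)

sumℚ-zero : ∀ {qs} → All (_≡ 0ℚ) qs → foldr ℚ._+_ 0ℚ qs ≡ 0ℚ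
sumℚ-zero []          = refl
sumℚ-zero (refl ∷ ps) = trans (cong (0ℚ ℚ.+_) (sumℚ-zero ps)) (ℚₚ.+-identityʳ 0ℚ)

-- Tables that differ only in hidden input cards

input⇒¬work : ∀ {n m} {p : Fin m} → InputPos n p → ¬ WorkPos n p
input⇒¬work input work = ℕₚ.<-irrefl refl (ℕₚ.<-≤-trans input work)

lookup-vis : ∀ {m} (c : Config m) p → lookup (vis c) p ≡ visCard (lookup c p)
lookup-vis c p = Vecₚ.lookup-map p visCard c

module HiddenInputs (n : ℕ) {m : ℕ} where

  infix 4 _≈_

  Alike : Fin m → Maybe Card → Maybe Card → Set
  Alike p u u' = u ≡ u' ⊎ (InputPos n p × visCard u ≡ visCard u')

  record _≈_ (c c' : Config m) : Set where
    constructor pointwise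
    field at : ∀ p → Alike p (lookup c p) (lookup c' p)
  open _≈_ public

  private variable
    c c' c₁ : Config m

  ≈-sym : c ≈ c' → c' ≈ c
  ≈-sym c≈c' = pointwise λ p → case at c≈c' p of λ where
    (inj₁ eq)           → inj₁ (sym eq)
    (inj₂ (input , eq)) → inj₂ (input , sym eq)

  ≈-visCard : c ≈ c' → ∀ p → visCard (lookup c p) ≡ visCard (lookup c' p)
  ≈-visCard c≈c' p with at c≈c' p
  ... | inj₁ eq       = cong visCard eq
  ... | inj₂ (_ , eq) = eq

  ≈-vis : c ≈ c' → vis c ≡ vis c'
  ≈-vis {c} {c'} c≈c' = Pointwise-≡⇒≡ (ext λ p →
    trans (lookup-vis c p) (trans (≈-visCard c≈c' p) (sym (lookup-vis c' p))))

  ≈-work : c ≈ c' → ∀ p → WorkPos n p → lookup c p ≡ lookup c' p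
  ≈-work c≈c' p work with at c≈c' p
  ... | inj₁ eq          = eq
  ... | inj₂ (input , _) = ⊥-elim (input⇒¬work {n} input work)

  ≈-update : c ≈ c' → ∀ q u → (c [ q ]≔ u) ≈ (c' [ q ]≔ u)
  ≈-update {c} {c'} c≈c' q u = pointwise cell
    where
    cell : ∀ p → Alike p (lookup (c [ q ]≔ u) p) (lookup (c' [ q ]≔ u) p)
    cell p with q ≟ p
    ... | yes refl = inj₁ (trans (Vecₚ.lookup∘update q c u) (sym (Vecₚ.lookup∘update q c' u)))
    ... | no q≢p
      rewrite Vecₚ.lookup∘update′ (q≢p ∘ sym) c u | Vecₚ.lookup∘update′ (q≢p ∘ sym) c' u = at c≈c' p

  moveOutcome : Maybe Card → Maybe Card → Config m → Fin m → Fin m → Config m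
  moveOutcome (just k) nothing c i j = (c [ i ]≔ nothing) [ j ]≔ just k
  moveOutcome _        _       c i j = c

  outcomes-move : ∀ pl i j (c : Config m) →
                  outcomes {n} (move pl i j) c ≡ moveOutcome (lookup c i) (lookup c j) c i j ∷ []
  outcomes-move pl i j c with lookup c i | lookup c j
  ... | just _  | nothing = refl
  ... | just _  | just _  = refl
  ... | nothing | _       = refl

  moveOutcome-≈ : ∀ {u u' o o'} → u ≡ u' → visCard o ≡ visCard o' → c ≈ c' →
                  ∀ i j → moveOutcome u o c i j ≈ moveOutcome u' o' c' i j
  moveOutcome-≈ {u = nothing} refl _ c≈c' i j = c≈c'
  moveOutcome-≈ {u = just k} {o = nothing} {nothing} refl _ c≈c' i j =
    ≈-update (≈-update c≈c' i nothing) j (just k)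
  moveOutcome-≈ {u = just _} {o = just _} {just _} refl _ c≈c' i j = c≈c'
  moveOutcome-≈ {u = just _} {o = nothing} {just (_ , true)}  refl ()
  moveOutcome-≈ {u = just _} {o = nothing} {just (_ , false)} refl ()
  moveOutcome-≈ {u = just _} {o = just (_ , true)}  {nothing} refl ()
  moveOutcome-≈ {u = just _} {o = just (_ , false)} {nothing} refl ()

  shuffle-fixes-inputs : ∀ (S : ShuffleSpec n m) {π q} → π ∈ ShuffleSpec.Γ S → InputPos n q →
                         π ⟨$⟩ʳ q ≡ q
  shuffle-fixes-inputs S {π} {q} π∈Γ input with lookup (ShuffleSpec.T S) q in q∈T
  ... | true  = ⊥-elim (input⇒¬work {n} input (ShuffleSpec.T⊆work S q q∈T))
  ... | false = All.lookup (ShuffleSpec.fixes S) π∈Γ q q∈T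

  readPosition : Action n m → Maybe (Fin m)
  readPosition (move _ i _)  = just i
  readPosition (turn _ i)    = just i
  readPosition (shuffle _ _) = nothing

  permute : Permutation′ m → Config m → Config m
  permute π d = tabulate (λ j → lookup d (π ⟨$⟩ˡ j))

  -- Only the card at the read position can be carried out of the input positions or turned;
  -- shuffles fix input positions.
  outcomes-≈ : ∀ a → c ≈ c' → (∀ {i} → readPosition a ≡ just i → lookup c i ≡ lookup c' i) →
               c₁ ∈ outcomes a c → ∃ λ c₁' → c₁' ∈ outcomes a c' × c₁ ≈ c₁'
  outcomes-≈ {c} {c'} (move pl i j) c≈c' read c₁∈
    rewrite outcomes-move pl i j c | outcomes-move pl i j c' with here refl ← c₁∈ =
      _ , here refl , moveOutcome-≈ (read refl) (≈-visCard c≈c' j) c≈c' i j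
  outcomes-≈ {c} {c'} (turn pl i) c≈c' read (here refl) =
    _ , here refl , subst (λ u → (c [ i ]≔ flipCard (lookup c i)) ≈ (c' [ i ]≔ flipCard u))
                          (read refl) (≈-update c≈c' i (flipCard (lookup c i)))
  outcomes-≈ {c} {c'} (shuffle pl S) c≈c' _ c₁∈ with ∈-map⁻ (λ π → permute π c) c₁∈
  ... | π , π∈Γ , refl = permute π c' , ∈-map⁺ (λ π → permute π c') π∈Γ , pointwise cell
    where
    cell : ∀ p → Alike p (lookup (permute π c) p) (lookup (permute π c') p)
    cell p rewrite Vecₚ.lookup∘tabulate (λ j → lookup c (π ⟨$⟩ˡ j)) p
                 | Vecₚ.lookup∘tabulate (λ j → lookup c' (π ⟨$⟩ˡ j)) p with at c≈c' (π ⟨$⟩ˡ p)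
    ... | inj₁ eq           = inj₁ eq
    ... | inj₂ (input , eq) =
      inj₂ (subst (InputPos n) (trans (sym (shuffle-fixes-inputs S π∈Γ input)) (inverseʳ π)) input , eq)

data Split (k l : ℕ) : Fin (k + l) → Set where
  left  : ∀ i → Split k l (i ↑ˡ l)
  right : ∀ j → Split k l (k ↑ʳ j)

split : ∀ k {l} (i : Fin (k + l)) → Split k l i
split zero    j       = right j
split (suc k) zero    = left zero
split (suc k) (suc i) with split k i
... | left i  = left (suc i)
... | right j = right j

lookup-encode : ∀ {n} (x : Vec Bool n) (a : Fin (n * 2)) →
                let (ℓ , r) = remQuot 2 a in lookup (encode x) a ≡ lookup (encodeBit (lookup x ℓ)) r
lookup-encode {n} x a = begin
  lookup (encode x) a
    ≡⟨ cong (lookup (encode x)) (sym (Finₚ.combine-remQuot {n} 2 a)) ⟩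
  lookup (Vec.concat (Vec.map encodeBit x)) (combine ℓ r)
    ≡⟨ Vecₚ.lookup-concat (Vec.map encodeBit x) ℓ r ⟩
  lookup (lookup (Vec.map encodeBit x) ℓ) r
    ≡⟨ cong (λ v → lookup v r) (Vecₚ.lookup-map ℓ encodeBit x) ⟩
  lookup (encodeBit (lookup x ℓ)) r
    ∎
  where
  open ≡-Reasoning
  ℓ = proj₁ (remQuot {n} 2 a)
  r = proj₂ (remQuot {n} 2 a)

encodeBit-faceDown : ∀ b r → proj₂ (lookup (encodeBit b) r) ≡ false
encodeBit-faceDown true  zero       = refl
encodeBit-faceDown true  (suc zero) = refl
encodeBit-faceDown false zero       = refl
encodeBit-faceDown false (suc zero) = refl

inputCell : Maybe (Maybe Suit) → Card → Maybe Card
inputCell nothing         _       = nothing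
inputCell (just nothing)  (σ , _) = just (σ , false)
inputCell (just (just σ)) _       = just (σ , true)

visCard-inputCell : ∀ u k → visCard (inputCell u k) ≡ u
visCard-inputCell nothing         _ = refl
visCard-inputCell (just nothing)  _ = refl
visCard-inputCell (just (just σ)) _ = refl

inputCell-visCard : ∀ o k → proj₂ k ≡ false → (∀ card → o ≡ just card → proj₁ card ≡ proj₁ k) →
                    inputCell (visCard o) k ≡ o
inputCell-visCard nothing            _           _    _    = refl
inputCell-visCard (just (σ , true))  _           _    _    = refl
inputCell-visCard (just (σ , false)) (σ' , .false) refl suit with refl ← suit _ refl = refl

visCard-faceDown : ∀ k → proj₂ k ≡ false → visCard (just k) ≡ just nothing
visCard-faceDown (σ , .false) refl = refl

Workspace : ℕ → Set
Workspace s = Vec (Maybe Card) s × Vec (Maybe Card) s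

-- var assigns the junk variable ℓ₀ to work positions, where the value read never matters.
module Table (n s : ℕ) (ℓ₀ : Fin (n + n)) where

  m : ℕ
  m = tableSize n s

  aliceCell bobCell : Fin (n * 2) → Fin m
  aliceCell a = (a ↑ˡ (n * 2 + s)) ↑ˡ s
  bobCell   b = (n * 2 ↑ʳ (b ↑ˡ s)) ↑ˡ s

  deckCell spareCell : Fin s → Fin m
  deckCell  d = (n * 2 ↑ʳ (n * 2 ↑ʳ d)) ↑ˡ s
  spareCell e = (n * 2 + (n * 2 + s)) ↑ʳ e

  data Place : Fin m → Set where
    inAlice : ∀ a → Place (aliceCell a)
    inBob   : ∀ b → Place (bobCell b)
    inDeck  : ∀ d → Place (deckCell d)
    inSpare : ∀ e → Place (spareCell e)

  place : ∀ p → Place p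
  place p with split (n * 2 + (n * 2 + s)) p
  ... | right e = inSpare e
  ... | left q  with split (n * 2) q
  ...   | left a  = inAlice a
  ...   | right r with split (n * 2) r
  ...     | left b  = inBob b
  ...     | right d = inDeck d

  alice-input : ∀ a → InputPos n (aliceCell a)
  alice-input a
    rewrite Finₚ.toℕ-↑ˡ (a ↑ˡ (n * 2 + s)) s | Finₚ.toℕ-↑ˡ a (n * 2 + s) =
    ℕₚ.≤-trans (Finₚ.toℕ<n a) (ℕₚ.m≤m+n (n * 2) (n * 2))

  bob-input : ∀ b → InputPos n (bobCell b)
  bob-input b
    rewrite Finₚ.toℕ-↑ˡ (n * 2 ↑ʳ (b ↑ˡ s)) s | Finₚ.toℕ-↑ʳ (n * 2) (b ↑ˡ s) | Finₚ.toℕ-↑ˡ b s =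
    ℕₚ.+-monoʳ-< (n * 2) (Finₚ.toℕ<n b)

  deck-work : ∀ d → WorkPos n (deckCell d)
  deck-work d
    rewrite Finₚ.toℕ-↑ˡ (n * 2 ↑ʳ (n * 2 ↑ʳ d)) s | Finₚ.toℕ-↑ʳ (n * 2) (n * 2 ↑ʳ d)
          | Finₚ.toℕ-↑ʳ (n * 2) d =
    ℕₚ.+-monoʳ-≤ (n * 2) (ℕₚ.m≤m+n (n * 2) (toℕ d))

  spare-work : ∀ e → WorkPos n (spareCell e)
  spare-work e
    rewrite Finₚ.toℕ-↑ʳ (n * 2 + (n * 2 + s)) e =
    ℕₚ.≤-trans (ℕₚ.+-monoʳ-≤ (n * 2) (ℕₚ.m≤m+n (n * 2) s)) (ℕₚ.m≤m+n _ (toℕ e))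

  private variable
    A     : Set
    as bs : Vec A (n * 2)
    ds es : Vec A s

  -- Opaque so that Agda can infer the four parts of a layout from a lookup in it.
  opaque
    layout : Vec A (n * 2) → Vec A (n * 2) → Vec A s → Vec A s → Vec A m
    layout as bs ds es = (as ++ (bs ++ ds)) ++ es

    layout-alice : ∀ a → lookup (layout as bs ds es) (aliceCell a) ≡ lookup as a
    layout-alice {as = as} {bs} {ds} {es} a =
      trans (Vecₚ.lookup-++ˡ (as ++ (bs ++ ds)) es _) (Vecₚ.lookup-++ˡ as (bs ++ ds) a)

    layout-bob : ∀ b → lookup (layout as bs ds es) (bobCell b) ≡ lookup bs b
    layout-bob {as = as} {bs} {ds} {es} b =
      trans (Vecₚ.lookup-++ˡ (as ++ (bs ++ ds)) es _)
            (trans (Vecₚ.lookup-++ʳ as (bs ++ ds) _) (Vecₚ.lookup-++ˡ bs ds b))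

    layout-deck : ∀ d → lookup (layout as bs ds es) (deckCell d) ≡ lookup ds d
    layout-deck {as = as} {bs} {ds} {es} d =
      trans (Vecₚ.lookup-++ˡ (as ++ (bs ++ ds)) es _)
            (trans (Vecₚ.lookup-++ʳ as (bs ++ ds) _) (Vecₚ.lookup-++ʳ bs ds d))

    layout-spare : ∀ e → lookup (layout as bs ds es) (spareCell e) ≡ lookup es e
    layout-spare {as = as} {bs} {ds} {es} e = Vecₚ.lookup-++ʳ (as ++ (bs ++ ds)) es e

    initialConfig-layout : ∀ x y deck → initialConfig {n} x y deck ≡
      layout (Vec.map just (encode x)) (Vec.map just (encode y)) (Vec.map just deck) (replicate s nothing)
    initialConfig-layout x y deck = cong (_++ replicate s nothing)
      (trans (Vecₚ.map-++ just (encode x) _)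
             (cong (Vec.map just (encode x) ++_) (Vecₚ.map-++ just (encode y) deck)))

  input-or-work : ∀ (p : Fin m) → InputPos n p ⊎ WorkPos n p
  input-or-work p = ℕₚ.<-≤-connex (toℕ p) (inputSize n)

  restrict : Config m → Workspace s
  restrict c = tabulate (lookup c ∘ deckCell) , tabulate (lookup c ∘ spareCell)

  restrict-cong : ∀ c c' → (∀ p → WorkPos n p → lookup c p ≡ lookup c' p) → restrict c ≡ restrict c'
  restrict-cong c c' same = cong₂ _,_ (Vecₚ.tabulate-cong λ d → same _ (deck-work d))
                                 (Vecₚ.tabulate-cong λ e → same _ (spare-work e))

  quotient : Fin (n * 2) → Fin n
  quotient a = proj₁ (remQuot {n} 2 a)

  remainder : Fin (n * 2) → Fin 2
  remainder a = proj₂ (remQuot {n} 2 a)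

  var : Fin m → Fin (n + n)
  var = lookup (layout (tabulate λ a → quotient a ↑ˡ n) (tabulate λ b → n ↑ʳ quotient b)
                       (replicate s ℓ₀) (replicate s ℓ₀))

  parity : Fin m → Fin 2
  parity = lookup (layout (tabulate remainder) (tabulate remainder) (replicate s zero) (replicate s zero))

  inputCard : (Fin (n + n) → Bool) → Fin m → Card
  inputCard z p = lookup (encodeBit (z (var p))) (parity p)

  var-alice : ∀ a → var (aliceCell a) ≡ quotient a ↑ˡ n
  var-alice a = trans (layout-alice a) (Vecₚ.lookup∘tabulate _ a)

  var-bob : ∀ b → var (bobCell b) ≡ n ↑ʳ quotient b
  var-bob b = trans (layout-bob b) (Vecₚ.lookup∘tabulate _ b)

  parity-alice : ∀ a → parity (aliceCell a) ≡ remainder a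
  parity-alice a = trans (layout-alice a) (Vecₚ.lookup∘tabulate _ a)

  parity-bob : ∀ b → parity (bobCell b) ≡ remainder b
  parity-bob b = trans (layout-bob b) (Vecₚ.lookup∘tabulate _ b)

  inputCard-alice : ∀ (x y : Vec Bool n) a → inputCard (lookup (x ++ y)) (aliceCell a) ≡ lookup (encode x) a
  inputCard-alice x y a rewrite var-alice a | parity-alice a | Vecₚ.lookup-++ˡ x y (quotient a) =
    sym (lookup-encode x a)

  inputCard-bob : ∀ (x y : Vec Bool n) b → inputCard (lookup (x ++ y)) (bobCell b) ≡ lookup (encode y) b
  inputCard-bob x y b rewrite var-bob b | parity-bob b | Vecₚ.lookup-++ʳ x y (quotient b) =
    sym (lookup-encode y b)

  initial-input : ∀ (x y : Vec Bool n) (deck : Vec Card s) p → InputPos n p →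
                  lookup (initialConfig x y deck) p ≡ just (inputCard (lookup (x ++ y)) p)
  initial-input x y deck p input rewrite initialConfig-layout x y deck with place p
  ... | inAlice a =
    trans (layout-alice a) (trans (Vecₚ.lookup-map a just (encode x)) (cong just (sym (inputCard-alice x y a))))
  ... | inBob b   =
    trans (layout-bob b) (trans (Vecₚ.lookup-map b just (encode y)) (cong just (sym (inputCard-bob x y b))))
  ... | inDeck d  = ⊥-elim (input⇒¬work {n} input (deck-work d))
  ... | inSpare e = ⊥-elim (input⇒¬work {n} input (spare-work e))

  initial-work : ∀ (x y x' y' : Vec Bool n) (deck : Vec Card s) p → WorkPos n p →
                 lookup (initialConfig x y deck) p ≡ lookup (initialConfig x' y' deck) p
  initial-work x y x' y' deck p work
    rewrite initialConfig-layout x y deck | initialConfig-layout x' y' deck with place p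
  ... | inAlice a = ⊥-elim (input⇒¬work {n} (alice-input a) work)
  ... | inBob b   = ⊥-elim (input⇒¬work {n} (bob-input b) work)
  ... | inDeck d  = trans (layout-deck d) (sym (layout-deck d))
  ... | inSpare e = trans (layout-spare e) (sym (layout-spare e))

  inputCard-faceDown : ∀ z p → proj₂ (inputCard z p) ≡ false
  inputCard-faceDown z p = encodeBit-faceDown (z (var p)) (parity p)

  initial-vis : ∀ x y x' y' deck → vis (initialConfig {n} x y deck) ≡ vis (initialConfig x' y' deck)
  initial-vis x y x' y' deck = Pointwise-≡⇒≡ (ext cell)
    where
    c₀ c₀' : Config m
    c₀  = initialConfig x y deck
    c₀' = initialConfig x' y' deck
    visibleCell : ∀ p → visCard (lookup c₀ p) ≡ visCard (lookup c₀' p)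
    visibleCell p with input-or-work p
    ... | inj₂ work  = cong visCard (initial-work x y x' y' deck p work)
    ... | inj₁ input rewrite initial-input x y deck p input | initial-input x' y' deck p input =
      trans (visCard-faceDown _ (inputCard-faceDown (lookup (x ++ y) ) p))
            (sym (visCard-faceDown _ (inputCard-faceDown (lookup (x' ++ y')) p)))
    cell : ∀ p → lookup (vis c₀) p ≡ lookup (vis c₀') p
    cell p = trans (lookup-vis c₀ p) (trans (visibleCell p) (sym (lookup-vis c₀' p)))

  initial-restrict : ∀ x y x' y' deck →
                     restrict (initialConfig {n} x y deck) ≡ restrict (initialConfig x' y' deck)
  initial-restrict x y x' y' deck =
    restrict-cong (initialConfig x y deck) (initialConfig x' y' deck) (initial-work x y x' y' deck)

  inputCellAt : Visible m → (Fin (n + n) → Bool) → Fin m → Maybe Card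
  inputCellAt v z p = inputCell (lookup v p) (inputCard z p)

  rebuild : Visible m → (Fin (n + n) → Bool) → Workspace s → Config m
  rebuild v z (ds , es) =
    layout (tabulate (inputCellAt v z ∘ aliceCell)) (tabulate (inputCellAt v z ∘ bobCell)) ds es

  rebuild-input : ∀ v z w p → InputPos n p → lookup (rebuild v z w) p ≡ inputCellAt v z p
  rebuild-input v z w p input with place p
  ... | inAlice a = trans (layout-alice a) (Vecₚ.lookup∘tabulate (inputCellAt v z ∘ aliceCell) a)
  ... | inBob b   = trans (layout-bob b) (Vecₚ.lookup∘tabulate (inputCellAt v z ∘ bobCell) b)
  ... | inDeck d  = ⊥-elim (input⇒¬work {n} input (deck-work d))
  ... | inSpare e = ⊥-elim (input⇒¬work {n} input (spare-work e))

  rebuild-restrict : ∀ v z c p → WorkPos n p → lookup (rebuild v z (restrict c)) p ≡ lookup c p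
  rebuild-restrict v z c p work with place p
  ... | inAlice a = ⊥-elim (input⇒¬work {n} (alice-input a) work)
  ... | inBob b   = ⊥-elim (input⇒¬work {n} (bob-input b) work)
  ... | inDeck d  = trans (layout-deck d) (Vecₚ.lookup∘tabulate _ d)
  ... | inSpare e = trans (layout-spare e) (Vecₚ.lookup∘tabulate _ e)

  restrict-rebuild : ∀ v z w → restrict (rebuild v z w) ≡ w
  restrict-rebuild v z (ds , es) =
    cong₂ _,_ (trans (Vecₚ.tabulate-cong layout-deck) (Vecₚ.tabulate∘lookup ds))
              (trans (Vecₚ.tabulate-cong layout-spare) (Vecₚ.tabulate∘lookup es))

  rebuild-work : ∀ v v' z z' w p → WorkPos n p → lookup (rebuild v z w) p ≡ lookup (rebuild v' z' w) p
  rebuild-work v v' z z' w p work = begin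
    lookup (rebuild v z w) p                              ≡⟨ cong (λ w → lookup (rebuild v z w) p) (sym restricted) ⟩
    lookup (rebuild v z (restrict (rebuild v' z' w))) p   ≡⟨ rebuild-restrict v z (rebuild v' z' w) p work ⟩
    lookup (rebuild v' z' w) p                            ∎
    where
    open ≡-Reasoning
    restricted = restrict-rebuild v' z' w

  InputsIntact : Vec Bool n → Vec Bool n → Vec Card s → Config m → Set
  InputsIntact x y deck c = ∀ i → InputPos n i → ∀ card → lookup c i ≡ just card →
                            ∃ λ σ → lookup (initialConfig {n} x y deck) i ≡ just (proj₁ card , σ)

  rebuild-intact : ∀ x y deck c → InputsIntact x y deck c → rebuild (vis c) (lookup (x ++ y)) (restrict c) ≡ c
  rebuild-intact x y deck c intact = Pointwise-≡⇒≡ (ext cell)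
    where
    z = lookup (x ++ y)
    cell : ∀ p → lookup (rebuild (vis c) z (restrict c)) p ≡ lookup c p
    cell p with input-or-work p
    ... | inj₂ work  = rebuild-restrict (vis c) z c p work
    ... | inj₁ input = begin
      lookup (rebuild (vis c) z (restrict c)) p
        ≡⟨ rebuild-input (vis c) z (restrict c) p input ⟩
      inputCell (lookup (vis c) p) (inputCard z p)
        ≡⟨ cong (λ u → inputCell u (inputCard z p)) (lookup-vis c p) ⟩
      inputCell (visCard (lookup c p)) (inputCard z p)
        ≡⟨ inputCell-visCard (lookup c p) _ (inputCard-faceDown z p) suit ⟩
      lookup c p
        ∎
      where
      open ≡-Reasoning
      suit : ∀ card → lookup c p ≡ just card → proj₁ card ≡ proj₁ (inputCard z p)
      suit card eq = let (σ , initial) = intact p input card eq in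
        cong proj₁ (just-injective (trans (sym initial) (initial-input x y deck p input)))

  open HiddenInputs n

  rebuild-≈ : ∀ v z z' w → rebuild v z w ≈ rebuild v z' w
  rebuild-≈ v z z' w = pointwise cell
    where
    cell : ∀ p → Alike p (lookup (rebuild v z w) p) (lookup (rebuild v z' w) p)
    cell p with input-or-work p
    ... | inj₂ work  = inj₁ (rebuild-work v v z z' w p work)
    ... | inj₁ input rewrite rebuild-input v z w p input | rebuild-input v z' w p input =
      inj₂ (input , trans (visCard-inputCell _ _) (sym (visCard-inputCell _ _)))

  ≈-restrict : ∀ {c c'} → c ≈ c' → restrict c ≡ restrict c'
  ≈-restrict {c} {c'} c≈c' = restrict-cong c c' (≈-work c≈c')

  rebuild-agree : ∀ v z z' w p → z (var p) ≡ z' (var p) →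
                  lookup (rebuild v z w) p ≡ lookup (rebuild v z' w) p
  rebuild-agree v z z' w p eq with input-or-work p
  ... | inj₂ work  = rebuild-work v v z z' w p work
  ... | inj₁ input rewrite rebuild-input v z w p input | rebuild-input v z' w p input =
    cong (λ b → inputCell (lookup v p) (lookup (encodeBit b) (parity p))) eq

module Execution {n s : ℕ} (P : Protocol n s) where

  private
    m : ℕ
    m = tableSize n s

  data Reachable (c₀ : Config m) : List (Visible m) → Config m → Set where
    start : Reachable c₀ [] c₀
    step  : ∀ {past c a c₁} → Reachable c₀ past c → next P (vis c) past ≡ act a →
            c₁ ∈ outcomes a c → Reachable c₀ (vis c ∷ past) c₁

  always-reachable : ∀ {R Q c₀ past c} k → Always n s P R Q (length past + k) [] c₀ →
                     Reachable c₀ past c → Always n s P R Q k past c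
  always-reachable k always start = always
  always-reachable {R} {Q} {c₀} k always (step {past} {c} reach e c₁∈) =
    All.lookup (subst (alwaysD n s P R Q (suc k) past c) e (proj₂ (always-reachable (suc k) always′ reach)))
               c₁∈
    where
    always′ : Always n s P R Q (length past + suc k) [] c₀
    always′ = subst (λ t → Always n s P R Q t [] c₀) (sym (ℕₚ.+-suc (length past) k)) always

  always-stop : ∀ {R Q k past c i j} → Always n s P R Q k past c → next P (vis c) past ≡ stop i j → Q c i j
  always-stop {R} {Q} {k} {past} {c} always e = subst (alwaysD n s P R Q k past c) e (proj₂ always)

  data Follows : List (Visible m) → Config m → List (Visible m) → Set where
    stops : ∀ {past c i j} → next P (vis c) past ≡ stop i j → Follows past c []
    acts  : ∀ {past c a c₁ v rest} → next P (vis c) past ≡ act a → c₁ ∈ outcomes a c →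
            vis c₁ ≡ v → Follows (vis c ∷ past) c₁ rest → Follows past c (v ∷ rest)

  outcomes-nonempty : ∀ (a : Action n m) c → ∃ λ c₁ → c₁ ∈ outcomes a c
  outcomes-nonempty (move _ i j) c with lookup c i | lookup c j
  ... | just _  | nothing = _ , here refl
  ... | just _  | just _  = _ , here refl
  ... | nothing | _       = _ , here refl
  outcomes-nonempty (turn _ i) c = _ , here refl
  outcomes-nonempty (shuffle _ S) c with ShuffleSpec.Γ S | ShuffleSpec.nonEmpty S
  ... | []    | nonEmpty = ⊥-elim (nonEmpty refl)
  ... | π ∷ _ | _        = _ , here refl

  halts⇒follows : ∀ L past c → Halts n s P L past c → ∃ λ rest → Follows past c rest × length rest ≤ L
  halts⇒follows L past c halts with next P (vis c) past in e
  ... | stop i j = [] , stops e , z≤n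
  halts⇒follows zero    past c () | act a
  halts⇒follows (suc L) past c halts | act a =
    let (c₁ , c₁∈)          = outcomes-nonempty a c
        (rest , F , length≤) = halts⇒follows L (vis c ∷ past) c₁ (All.lookup halts c₁∈)
    in vis c₁ ∷ rest , acts e c₁∈ refl F , s≤s length≤

  private
    reciprocal-pos : ∀ k → ℚ.Positive ((+ 1) / suc k)
    reciprocal-pos k = ℚₚ.normalize-pos 1 (suc k)

  average-nonneg : ∀ {qs} → All (0ℚ ℚ.≤_) qs → 0ℚ ℚ.≤ average n s P qs
  average-nonneg {[]}     _      = ℚₚ.≤-refl
  average-nonneg {q ∷ qs} nonneg = ℚₚ.≤-trans (ℚₚ.≤-reflexive (sym (ℚₚ.*-zeroˡ r)))
    (ℚₚ.*-monoʳ-≤-nonNeg r {{ℚₚ.pos⇒nonNeg r {{reciprocal-pos (length qs)}}}} (sumℚ-nonneg nonneg))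
    where r = (+ 1) / suc (length qs)

  average-pos : ∀ {qs} → All (0ℚ ℚ.≤_) qs → Any (0ℚ ℚ.<_) qs → 0ℚ ℚ.< average n s P qs
  average-pos {q ∷ qs} nonneg pos = ℚₚ.≤-<-trans (ℚₚ.≤-reflexive (sym (ℚₚ.*-zeroˡ r)))
    (ℚₚ.*-monoˡ-<-pos r {{reciprocal-pos (length qs)}} (sumℚ-pos nonneg pos))
    where r = (+ 1) / suc (length qs)

  average-zero : ∀ {qs} → All (_≡ 0ℚ) qs → average n s P qs ≡ 0ℚ
  average-zero {[]}     _     = refl
  average-zero {q ∷ qs} zeros = trans (cong (ℚ._* r) (sumℚ-zero zeros)) (ℚₚ.*-zeroˡ r)
    where r = (+ 1) / suc (length qs)

  average-nonzero : ∀ {qs} → ¬ average n s P qs ≡ 0ℚ → Any (λ q → ¬ q ≡ 0ℚ) qs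
  average-nonzero {qs} nonzero = Allₚ.¬All⇒Any¬ (ℚ._≟ 0ℚ) qs (nonzero ∘ average-zero)

  mutual
    prob-nonneg : ∀ k past c tr → 0ℚ ℚ.≤ prob n s P k past c tr
    prob-nonneg k past c []         = ℚₚ.≤-refl
    prob-nonneg k past c (v ∷ rest) with vis c ≟ᵛ v
    ... | no _  = ℚₚ.≤-refl
    ... | yes _ = probD-nonneg k past c rest (next P (vis c) past)

    probD-nonneg : ∀ k past c rest d → 0ℚ ℚ.≤ probD n s P k past c rest d
    probD-nonneg k       past c []      (stop _ _) = ℚₚ.<⇒≤ (ℚₚ.positive⁻¹ 1ℚ)
    probD-nonneg k       past c (_ ∷ _) (stop _ _) = ℚₚ.≤-refl
    probD-nonneg zero    past c []      (act _)    = ℚₚ.≤-refl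
    probD-nonneg zero    past c (_ ∷ _) (act _)    = ℚₚ.≤-refl
    probD-nonneg (suc k) past c rest@[]      (act a) = average-nonneg (probs-nonneg k past c rest a)
    probD-nonneg (suc k) past c rest@(_ ∷ _) (act a) = average-nonneg (probs-nonneg k past c rest a)

    probs-nonneg : ∀ k past c rest (a : Action n m) →
                   All (0ℚ ℚ.≤_) (List.map (λ c₁ → prob n s P k (vis c ∷ past) c₁ rest) (outcomes a c))
    probs-nonneg k past c rest a =
      Allₚ.map⁺ (All.universal (λ c₁ → prob-nonneg k (vis c ∷ past) c₁ rest) (outcomes a c))

  mutual
    follows⇒prob-pos : ∀ {past c rest} k → Follows past c rest → length rest ≤ k →
                       0ℚ ℚ.< prob n s P k past c (vis c ∷ rest)
    follows⇒prob-pos {past} {c} k F length≤ with vis c ≟ᵛ vis c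
    ... | no ≢ = ⊥-elim (≢ refl)
    ... | yes _ = follows⇒probD-pos k F length≤

    follows⇒probD-pos : ∀ {past c rest} k → Follows past c rest → length rest ≤ k →
                        0ℚ ℚ.< probD n s P k past c rest (next P (vis c) past)
    follows⇒probD-pos k (stops e) _ rewrite e = ℚₚ.positive⁻¹ 1ℚ
    follows⇒probD-pos {past} {c} (suc k) (acts {a = a} {c₁} {rest = rest} e c₁∈ refl F) (s≤s length≤)
      rewrite e = average-pos (probs-nonneg k past c (vis c₁ ∷ rest) a)
                              (Anyₚ.map⁺ (lose c₁∈ (follows⇒prob-pos k F length≤)))

  mutual
    prob-nonzero⇒follows : ∀ k past c v rest → ¬ prob n s P k past c (v ∷ rest) ≡ 0ℚ →
                           vis c ≡ v × Follows past c rest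
    prob-nonzero⇒follows k past c v rest nonzero with vis c ≟ᵛ v
    ... | no _   = ⊥-elim (nonzero refl)
    ... | yes eq = eq , probD-nonzero⇒follows k past c rest nonzero

    probD-nonzero⇒follows : ∀ k past c rest → ¬ probD n s P k past c rest (next P (vis c) past) ≡ 0ℚ →
                            Follows past c rest
    probD-nonzero⇒follows k past c rest nonzero with next P (vis c) past in e
    probD-nonzero⇒follows k       past c []       nonzero | stop i j = stops e
    probD-nonzero⇒follows k       past c (_ ∷ _)  nonzero | stop i j = ⊥-elim (nonzero refl)
    probD-nonzero⇒follows zero    past c []       nonzero | act a    = ⊥-elim (nonzero refl)
    probD-nonzero⇒follows zero    past c (_ ∷ _)  nonzero | act a    = ⊥-elim (nonzero refl)
    probD-nonzero⇒follows (suc k) past c []       nonzero | act a    =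
      ⊥-elim (nonzero (average-zero (Allₚ.map⁺ {P = _≡ 0ℚ} {f = λ c₁ → prob n s P k (vis c ∷ past) c₁ []}
                                                (All.universal (λ _ → refl) (outcomes a c)))))
    probD-nonzero⇒follows (suc k) past c (v ∷ rest) nonzero | act a  =
      let (c₁ , c₁∈ , nonzero₁) = find (Anyₚ.map⁻ (average-nonzero nonzero))
          (eq , F)              = prob-nonzero⇒follows k (vis c ∷ past) c₁ v rest nonzero₁
      in acts e c₁∈ eq F

  follows-transfer : ∀ {k past c c' rest} →
                     prob n s P k past c' (vis c ∷ rest) ≡ prob n s P k past c (vis c ∷ rest) →
                     Follows past c rest → length rest ≤ k → vis c' ≡ vis c × Follows past c' rest
  follows-transfer {k} {past} {c} {c'} {rest} same F length≤ =
    prob-nonzero⇒follows k past c' (vis c) rest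
      (λ zero → ℚₚ.<-irrefl (trans (sym zero) same) (follows⇒prob-pos k F length≤))

-- The simulating branching program

finite-Card : Finite Card
finite-Card = finite-× finite-Suit finite-Bool

finite-Workspace : ∀ s → Finite (Workspace s)
finite-Workspace s = finite-× (finite-Vec (finite-Maybe finite-Card) s) (finite-Vec (finite-Maybe finite-Card) s)

finite-States : ∀ s → Finite (Subsets.Subset (finite-Workspace s))
finite-States s = finite-Vec finite-Bool (size (finite-Workspace s))

act-injective : ∀ {n m} {a a' : Action n m} → act a ≡ act a' → a ≡ a'
act-injective refl = refl

module Simulation {n s : ℕ} (ℓ₀ : Fin (n + n)) (P : Protocol n s) (deck : Vec Card s)
                  (f : Vec Bool n → Vec Bool n → Bool)
                  (read-only : ReadOnly P deck) (computes : Computes P deck f)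
                  (x₀ y₀ : Vec Bool n) where

  open Table n s ℓ₀
  open HiddenInputs n
  open Execution P
  open FiniteProperties (finite-Workspace s)
  open Subsets (finite-Workspace s)

  𝕊  = finite-States s
  𝕊×𝔹 = finite-× 𝕊 finite-Bool
  𝕊×𝔹×𝔹 = finite-× 𝕊×𝔹 finite-Bool

  b₀ : Bool
  b₀ = f x₀ y₀

  c₀ʳ : Config m
  c₀ʳ = initialConfig x₀ y₀ deck

  S₀ : Subset
  S₀ = fromDecidable λ w → ≡-dec w (restrict c₀ʳ)

  readVar : Action n m → Fin (n + n)
  readVar a = maybe var ℓ₀ (readPosition a)

  rebuild-reads : ∀ a v z w {i} → readPosition a ≡ just i →
                  lookup (rebuild v z w) i ≡ lookup (rebuild v (λ _ → z (readVar a)) w) i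
  rebuild-reads (move _ i _) v z w refl = rebuild-agree v z (λ _ → z (var i)) w i refl
  rebuild-reads (turn _ i)   v z w refl = rebuild-agree v z (λ _ → z (var i)) w i refl

  Successor : Action n m → Visible m → Bool → Workspace s → Visible m → Workspace s → Set
  Successor a v b w v' w' = Any (λ c → vis c ≡ v' × restrict c ≡ w') (outcomes a (rebuild v (λ _ → b) w))

  Transition : Action n m → Visible m → Visible m → Subset → Bool → Workspace s → Set
  Transition a v v' S b w' = ∃ λ w → T (member S w) × Successor a v b w v' w'

  transition? : ∀ a v v' S b → Decidable (Transition a v v' S b)
  transition? a v v' S b w' =
    ∃? λ w → T? (member S w) ×-dec Any.any? (λ c → (vis c ≟ᵛ v') ×-dec ≡-dec (restrict c) w') _

  transition : Action n m → Visible m → Visible m → Subset → Bool → Subset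
  transition a v v' S b = fromDecidable (transition? a v v' S b)

  assignment : Fin m → Bool → Bool → Fin (n + n) → Bool
  assignment j b₁ b₂ ℓ = if does (ℓ ≟ var j) then b₂ else b₁

  output : Visible m → Fin m → Fin m → Subset → Bool → Bool → Bool
  output v i j S b₁ b₂ with ∃? (T? ∘ member S)
  ... | yes (w , _) = let c = rebuild v (assignment j b₁ b₂) w
                      in fromMaybe false (decodePair (lookup c i) (lookup c j))
  ... | no _        = not b₀

  outputProgram : Visible m → Fin m → Fin m → LBP (n + n) (size 𝕊)
  outputProgram v i j =
    readLayer 𝕊 𝕊×𝔹 (var i) _,_ (readLayer 𝕊×𝔹 𝕊×𝔹×𝔹 (var j) _,_ (finalLayer 𝕊×𝔹×𝔹 λ ((S , b₁) , b₂) →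
      output v i j S b₁ b₂))

  lbpEval-outputProgram : ∀ v i j S z′ → lbpEval (outputProgram v i j) (index 𝕊 S) z′ ≡
                                         output v i j S (lookup z′ (var i)) (lookup z′ (var j))
  lbpEval-outputProgram v i j S z′ =
    trans (lbpEval-readLayer 𝕊 𝕊×𝔹 (var i) _,_ B₂ S z′)
    (trans (lbpEval-readLayer 𝕊×𝔹 𝕊×𝔹×𝔹 (var j) _,_ B₃ (S , lookup z′ (var i)) z′)
           (lbpEval-finalLayer 𝕊×𝔹×𝔹 h ((S , lookup z′ (var i)) , lookup z′ (var j)) z′))
    where
    h  = λ ((S , b₁) , b₂) → output v i j S b₁ b₂
    B₃ = finalLayer 𝕊×𝔹×𝔹 h
    B₂ = readLayer 𝕊×𝔹 𝕊×𝔹×𝔹 (var j) _,_ B₃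

  build : ∀ {past c rest} → Follows past c rest → LBP (n + n) (size 𝕊)
  build {c = c} (stops {i = i} {j} _) = outputProgram (vis c) i j
  build {c = c} (acts {a = a} {v = v'} _ _ _ F) = readLayer 𝕊 𝕊 (readVar a) (transition a (vis c) v') (build F)

  lbpLength-build : ∀ {past c rest} (F : Follows past c rest) → lbpLength (build F) ≡ length rest + 3
  lbpLength-build (stops _)      = refl
  lbpLength-build (acts _ _ _ F) = cong suc (lbpLength-build F)

  size-𝕊≤ : size 𝕊 ≤ size 𝕊×𝔹×𝔹
  size-𝕊≤ = ℕₚ.≤-trans (ℕₚ.m≤m*n (size 𝕊) 2) (ℕₚ.m≤m*n (size 𝕊 * 2) 2)

  lbpWidth-build : ∀ {past c rest} (F : Follows past c rest) → lbpWidth (build F) ≤ size 𝕊×𝔹×𝔹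
  lbpWidth-build (stops _)      = ℕₚ.⊔-lub size-𝕊≤ (ℕₚ.⊔-lub (ℕₚ.m≤m*n (size 𝕊 * 2) 2) ℕₚ.≤-refl)
  lbpWidth-build (acts _ _ _ F) = ℕₚ.⊔-lub size-𝕊≤ (lbpWidth-build F)

  module Correctness (x y : Vec Bool n) where

    z : Fin (n + n) → Bool
    z = lookup (x ++ y)

    c₀ : Config m
    c₀ = initialConfig x y deck

    Reached : List (Visible m) → Visible m → Workspace s → Set
    Reached past v w = ∃ λ c → Reachable c₀ past c × vis c ≡ v × restrict c ≡ w

    Tracks : List (Visible m) → Visible m → List (Visible m) → Set
    Tracks past v rest = f x y ≡ b₀ → ∃ λ c → Reachable c₀ past c × vis c ≡ v × Follows past c rest

    reachable-rebuild : ∀ {past c} → Reachable c₀ past c → rebuild (vis c) z (restrict c) ≡ c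
    reachable-rebuild {past} reach =
      rebuild-intact x y deck _ (proj₁ (always-reachable 0 (read-only x y (length past + 0)) reach))

    reachable-≈ : ∀ {past c} b → Reachable c₀ past c → c ≈ rebuild (vis c) (λ _ → b) (restrict c)
    reachable-≈ {c = c} b reach =
      subst (_≈ _) (reachable-rebuild reach) (rebuild-≈ (vis c) z (λ _ → b) (restrict c))

    reachable-reads : ∀ {past c} a → Reachable c₀ past c → ∀ {i} → readPosition a ≡ just i →
                      lookup c i ≡ lookup (rebuild (vis c) (λ _ → z (readVar a)) (restrict c)) i
    reachable-reads {c = c} a reach {i} read =
      trans (cong (λ c′ → lookup c′ i) (sym (reachable-rebuild reach)))
            (rebuild-reads a (vis c) z (restrict c) read)

    reached-step : ∀ {past v a} → next P v past ≡ act a → ∀ v' w' →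
                   (∃ λ w → Reached past v w × Successor a v (z (readVar a)) w v' w') ⇔
                   Reached (v ∷ past) v' w'
    reached-step {past} {v} {a} e v' w' = mk⇔ forth back
      where
      b = z (readVar a)
      forth : (∃ λ w → Reached past v w × Successor a v b w v' w') → Reached (v ∷ past) v' w'
      forth (_ , (c , reach , refl , refl) , successor) with find successor
      ... | c' , c'∈ , refl , refl
        with outcomes-≈ a (≈-sym (reachable-≈ b reach)) (sym ∘ reachable-reads a reach) c'∈
      ...   | c₁ , c₁∈ , c'≈c₁ = c₁ , step reach e c₁∈ , sym (≈-vis c'≈c₁) , sym (≈-restrict c'≈c₁)
      back : Reached (v ∷ past) v' w' → ∃ λ w → Reached past v w × Successor a v b w v' w'
      back (c₁ , step {c = c} reach e′ c₁∈ , refl , refl) with act-injective (trans (sym e) e′)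
      ... | refl with outcomes-≈ a (reachable-≈ b reach) (reachable-reads a reach) c₁∈
      ...   | c' , c'∈ , c₁≈c' =
        restrict c , (c , reach , refl , refl) , lose c'∈ (sym (≈-vis c₁≈c') , sym (≈-restrict c₁≈c'))

    transition-represents : ∀ {past v v' a} S → S Represents Reached past v → next P v past ≡ act a →
                            transition a v v' S (z (readVar a)) Represents Reached (v ∷ past) v'
    transition-represents {past} {v} {v'} {a} S S↔ e w' = mk⇔
      (λ t → let (w , w∈S , successor) = to (fromDecidable-represents P? w') t
             in to (reached-step e v' w') (w , to (S↔ w) w∈S , successor))
      (λ r → let (w , reached , successor) = from (reached-step e v' w') r
             in from (fromDecidable-represents P? w') (w , from (S↔ w) reached , successor))
      where P? = transition? a v v' S (z (readVar a))

    tracks-step : ∀ {past v v' rest} → Tracks past v (v' ∷ rest) → Tracks (v ∷ past) v' rest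
    tracks-step tracks same with tracks same
    ... | c , reach , refl , acts e c₁∈ vis≡ F = _ , step reach e c₁∈ , vis≡ , F

    assignment-agrees : ∀ i j → assignment j (z (var i)) (z (var j)) (var i) ≡ z (var i) ×
                                assignment j (z (var i)) (z (var j)) (var j) ≡ z (var j)
    assignment-agrees i j with var i ≟ var j | var j ≟ var j
    ... | yes eq | yes _ = cong z (sym eq) , refl
    ... | no _   | yes _ = refl , refl
    ... | _      | no ≢  = ⊥-elim (≢ refl)

    decode-reached : ∀ {past v i j w} → Reached past v w → next P v past ≡ stop i j →
                     let c′ = rebuild v (assignment j (z (var i)) (z (var j))) w
                     in decodePair (lookup c′ i) (lookup c′ j) ≡ just (f x y)
    decode-reached {past} {i = i} {j} (c , reach , refl , refl) e = begin
      decodePair (lookup c′ i) (lookup c′ j)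
        ≡⟨ cong₂ decodePair (agree i (proj₁ (assignment-agrees i j))) (agree j (proj₂ (assignment-agrees i j))) ⟩
      decodePair (lookup c i) (lookup c j)
        ≡⟨ always-stop (always-reachable 0 (computes x y (length past + 0)) reach) e ⟩
      just (f x y)
        ∎
      where
      open ≡-Reasoning
      z′ = assignment j (z (var i)) (z (var j))
      c′ = rebuild (vis c) z′ (restrict c)
      agree : ∀ p → z′ (var p) ≡ z (var p) → lookup c′ p ≡ lookup c p
      agree p eq = trans (rebuild-agree (vis c) z′ z (restrict c) p eq)
                         (cong (λ c → lookup c p) (reachable-rebuild reach))

    output-correct : ∀ {past v i j} S → S Represents Reached past v → Tracks past v [] →
                     next P v past ≡ stop i j → output v i j S (z (var i)) (z (var j)) ≡ f x y
    output-correct S S↔ tracks e with ∃? (T? ∘ member S)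
    ... | yes (w , w∈S) = cong (fromMaybe false) (decode-reached (to (S↔ w) w∈S) e)
    ... | no none       = sym (¬-not λ same →
      let (c , reach , vis≡ , _) = tracks same
      in none (restrict c , from (S↔ (restrict c)) (c , reach , vis≡ , refl)))

    eval-build : ∀ {past c rest} (F : Follows past c rest) S → S Represents Reached past (vis c) →
                 Tracks past (vis c) rest → lbpEval (build F) (index 𝕊 S) (x ++ y) ≡ f x y
    eval-build {c = c} (stops {i = i} {j} e) S S↔ tracks =
      trans (lbpEval-outputProgram (vis c) i j S (x ++ y)) (output-correct S S↔ tracks e)
    eval-build {c = c} (acts {a = a} {c₁} e c₁∈ refl F) S S↔ tracks =
      trans (lbpEval-readLayer 𝕊 𝕊 (readVar a) (transition a (vis c) (vis c₁)) (build F) S (x ++ y))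
            (eval-build F S′ (transition-represents S S↔ e) (tracks-step tracks))
      where S′ = transition a (vis c) (vis c₁) S (z (readVar a))

    initial-represents : S₀ Represents Reached [] (vis c₀ʳ)
    initial-represents w = mk⇔
      (λ w∈S₀ → c₀ , start , initial-vis x y x₀ y₀ deck ,
                trans (initial-restrict x y x₀ y₀ deck) (sym (to (fromDecidable-represents singleton? w) w∈S₀)))
      (λ { (c , start , _ , refl) → from (fromDecidable-represents singleton? w) (initial-restrict x y x₀ y₀ deck) })
      where singleton? = λ w → ≡-dec w (restrict c₀ʳ)

    initial-tracks : Secure P deck f → ∀ {k rest} → Follows [] c₀ʳ rest → length rest ≤ k →
                     Tracks [] (vis c₀ʳ) rest
    initial-tracks secure {k} {rest} F length≤ same =
      let (vis≡ , F′) = follows-transfer (secure x y x₀ y₀ same k (vis c₀ʳ ∷ rest)) F length≤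
      in c₀ , start , vis≡ , F′

secureReadOnly⇒branchingProgram :
  ∀ {n s} (ℓ₀ : Fin (n + n)) (P : Protocol n s) deck f L →
  ReadOnly P deck → Secure P deck f → Computes P deck f → LengthAtMost P deck L →
  let w = size (finite-States s) in
  Σ (LBP (n + n) w) λ B → Σ (Fin w) λ v₀ →
    lbpWidth B ≤ w * 2 * 2 × lbpLength B ≤ L + 3 × ((x y : Vec Bool n) → lbpEval B v₀ (x ++ y) ≡ f x y)
secureReadOnly⇒branchingProgram {n} ℓ₀ P deck f L read-only secure computes halts =
  build F₀ , index 𝕊 S₀ , lbpWidth-build F₀ ,
  ℕₚ.≤-trans (ℕₚ.≤-reflexive (lbpLength-build F₀)) (ℕₚ.+-monoˡ-≤ 3 length≤) ,
  λ x y → eval-build x y F₀ S₀ (initial-represents x y) (initial-tracks x y secure F₀ length≤)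
  where
  x₀ = replicate n false
  open Simulation ℓ₀ P deck f read-only computes x₀ x₀
  open Correctness
  reference = Execution.halts⇒follows P L [] c₀ʳ (halts x₀ x₀)
  F₀        = proj₁ (proj₂ reference)
  length≤   = proj₂ (proj₂ reference)

length-bound : ∀ n k → suc n ^ k + k + 3 ≤ suc n ^ (3 + k) + (3 + k)
length-bound n k = begin
  suc n ^ k + k + 3         ≡⟨ ℕₚ.+-assoc (suc n ^ k) k 3 ⟩
  suc n ^ k + (k + 3)       ≤⟨ ℕₚ.+-mono-≤ (ℕₚ.^-monoʳ-≤ (suc n) (ℕₚ.m≤n+m k 3))
                                            (ℕₚ.≤-reflexive (ℕₚ.+-comm k 3)) ⟩
  suc n ^ (3 + k) + (3 + k) ∎
  where open ℕₚ.≤-Reasoning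

theorem6 : (f : (n : ℕ) → Vec Bool n → Vec Bool n → Bool) →
    (Σ ℕ λ s → Σ ℕ λ k → (n : ℕ) →
       Σ (Vec Card s) λ deck → Σ (Protocol n s) λ P →
         Oblivious P × ReadOnly P deck × Secure P deck (f n) ×
         Computes P deck (f n) × LengthAtMost P deck (n ^ k + k)) →
    Σ ℕ λ W → Σ ℕ λ k → (n : ℕ) →
      Σ ℕ λ w → Σ (LBP (n + n) w) λ B → Σ (Fin w) λ v₀ →
        lbpWidth B ≤ W × lbpLength B ≤ n ^ k + k ×
        ((x y : Vec Bool n) → lbpEval B v₀ (x ++ y) ≡ f n x y)
theorem6 f (s , k , protocols) = suc (size (finite-States s) * 2 * 2) , 3 + k , λ where
  zero    → 1 , final (λ _ → f 0 [] []) , zero , s≤s z≤n , s≤s z≤n , λ { [] [] → refl }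
  (suc n) →
    let (deck , P , _ , read-only , secure , computes , halts) = protocols (suc n)
        (B , v₀ , width≤ , length≤ , correct) =
          secureReadOnly⇒branchingProgram zero P deck (f (suc n)) _ read-only secure computes halts
    in _ , B , v₀ , ℕₚ.m≤n⇒m≤1+n width≤ , ℕₚ.≤-trans length≤ (length-bound n k) , correct
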